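{- Let $G$ be a simple graph with at least two vertices. If $G$ has a $(k,d)$-shrubbery, then its cut-rank function $\rho_G$ has a $(k,d)$-decomposition.
   Context: For a simple graph $G=(V,E)$ and $X\subseteq V$, $\rho_G(X)$ is the rank over the binary field of the $X\times(V\setminus X)$ $0$-$1$ matrix whose $(i,j)$ entry is $1$ iff $i,j$ are adjacent. A $(k,d)$-shrubbery for $G$ is a rooted tree $T$ whose set of leaves is $V$, all at distance exactly $d$ from the root, together with $f:V\to\{1,\dots,k\}$ such that whenever $(x_1,y_1),(x_2,y_2)\in V^2$ satisfy $\mathrm{dist}_T(x_1,y_1)=\mathrm{dist}_T(x_2,y_2)$, $f(x_1)=f(x_2)$ and $f(y_1)=f(y_2)$, we have $x_1y_1\in E$ iff $x_2y_2\in E$. A decomposition of $\rho_G$ is a pair $(T,\sigma)$, $T$ a tree with at least one internal node and $\sigma$ a bijection from $V$ to the leaves of $T$; for an internal node $v$ the components of $T-v$ induce a partition $\mathcal P_v$ of $V$, the width of $v$ is $\max_{\mathcal P'\subseteq\mathcal P_v}\rho_G(\bigcup_{X\in\mathcal P'}X)$, the width of $(T,\sigma)$ is the maximum over internal nodes, and its radius is the minimum $r$ such that some node of $T$ is within distance $r$ of every node. A $(k,d)$-decomposition has width $\le k$ and radius $\le d$. -}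

module Defs where

open import Data.Nat using (ℕ; zero; suc; _+_; _≤_; _<_)
open import Data.Fin using (Fin; zero; suc; inject₁; fromℕ)
open import Data.Bool using (Bool; true; false; _∧_; not; _xor_)
open import Data.Product using (Σ; ∃; ∃-syntax; _×_; _,_)
open import Relation.Nullary using (¬_)
open import Data.Unit using (⊤)
open import Data.Sum using (_⊎_)
open import Relation.Binary.PropositionalEquality using (_≡_; _≢_)
open import Function using (_∘_)
open import Function.Bundles using (_⇔_)
open import Function.Definitions using (Injective)

record SimpleGraph (n : ℕ) : Set where
  field
    adj     : Fin n → Fin n → Bool
    symm    : ∀ x y → adj x y ≡ adj y x
    irrefl  : ∀ x → adj x x ≡ false

open SimpleGraph public

Edge : ∀ {n} → SimpleGraph n → Fin n → Fin n → Set
Edge G x y = adj G x y ≡ true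

Subset : ℕ → Set
Subset n = Fin n → Bool

_⊆_ : ∀ {n} → Subset n → Subset n → Set
S ⊆ T = ∀ x → S x ≡ true → T x ≡ true

Nonempty : ∀ {n} → Subset n → Set
Nonempty S = ∃[ x ] S x ≡ true

card : ∀ {n} → Subset n → ℕ
card {zero}  S = 0
card {suc n} S with S zero
... | true  = suc (card (S ∘ suc))
... | false = card (S ∘ suc)

xorSum : ∀ {n} → (Fin n → Bool) → Bool
xorSum {zero}  g = false
xorSum {suc n} g = g zero xor xorSum (g ∘ suc)

rowSum : ∀ {r c} → (Fin r → Fin c → Bool) → Subset r → Fin c → Bool
rowSum M S y = xorSum (λ x → S x ∧ M x y)

-- The rows indexed by S are linearly independent over GF(2):
-- no nonempty subfamily sums to the zero vector.
RowsIndependent : ∀ {r c} → (Fin r → Fin c → Bool) → Subset r → Set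
RowsIndependent M S =
  ∀ S' → S' ⊆ S → Nonempty S' → ∃[ y ] rowSum M S' y ≡ true

-- rank over GF(2) of the submatrix of M with rows in R is at most k:
-- every linearly independent set of rows (from R) has at most k elements.
RankRowsLE : ∀ {r c} → (Fin r → Fin c → Bool) → Subset r → ℕ → Set
RankRowsLE M R k = ∀ S → S ⊆ R → RowsIndependent M S → card S ≤ k

-- Cut-rank.  The X × (V∖X) adjacency matrix is represented with all
-- columns of V, the columns indexed by X being zeroed (this does not
-- change the rank).  CutRankLE G X k  means  ρ_G(X) ≤ k.

cutMatrix : ∀ {n} → SimpleGraph n → Subset n → Fin n → Fin n → Bool
cutMatrix G X x y = adj G x y ∧ not (X y)

CutRankLE : ∀ {n} → SimpleGraph n → Subset n → ℕ → Set
CutRankLE G X k = RankRowsLE (cutMatrix G X) X k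

data WalkIn {m} (T : SimpleGraph m) (P : Fin m → Set) :
            Fin m → Fin m → ℕ → Set where
  here : ∀ {u} → P u → WalkIn T P u u 0
  step : ∀ {u w v ℓ} → P u → Edge T u w → WalkIn T P w v ℓ →
         WalkIn T P u v (suc ℓ)

Walk : ∀ {m} → SimpleGraph m → Fin m → Fin m → ℕ → Set
Walk T = WalkIn T (λ _ → ⊤)

Dist : ∀ {m} → SimpleGraph m → Fin m → Fin m → ℕ → Set
Dist T u v ℓ = Walk T u v ℓ × (∀ ℓ' → ℓ' < ℓ → ¬ Walk T u v ℓ')

Connected : ∀ {m} → SimpleGraph m → Set
Connected T = ∀ u v → ∃[ ℓ ] Walk T u v ℓ

record Cycle {m} (T : SimpleGraph m) : Set where
  field
    len    : ℕ
    vert   : Fin (suc (suc (suc len))) → Fin m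
    inj    : Injective _≡_ _≡_ vert
    consec : ∀ (i : Fin (suc (suc len))) → Edge T (vert (inject₁ i)) (vert (suc i))
    close  : Edge T (vert (fromℕ (suc (suc len)))) (vert zero)

Acyclic : ∀ {m} → SimpleGraph m → Set
Acyclic T = ¬ Cycle T

IsTree : ∀ {m} → SimpleGraph m → Set
IsTree T = Connected T × Acyclic T

DegreeZero : ∀ {m} → SimpleGraph m → Fin m → Set
DegreeZero T v = ∀ w → adj T v w ≡ false

DegreeOne : ∀ {m} → SimpleGraph m → Fin m → Set
DegreeOne T v = ∃[ u ] (Edge T v u × (∀ w → Edge T v w → w ≡ u))

IsLeaf : ∀ {m} → SimpleGraph m → Fin m → Set
IsLeaf T v = DegreeOne T v

-- leaf of a tree rooted at r: node without children, i.e. a non-root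
-- node of degree 1, or the root if it has degree 0
IsRootedLeaf : ∀ {m} → SimpleGraph m → Fin m → Fin m → Set
IsRootedLeaf T r v = (v ≢ r × DegreeOne T v) ⊎ (v ≡ r × DegreeZero T v)

-- (k,d)-shrubbery: a rooted tree T (on Fin m, root r) whose set of
-- leaves is V (identified with V via the injection leaf), all leaves at
-- distance exactly d from the root, and f : V → {1,…,k} (= Fin k).

record Shrubbery {n} (G : SimpleGraph n) (k d : ℕ) : Set where
  field
    m        : ℕ
    T        : SimpleGraph m
    isTree   : IsTree T
    root     : Fin m
    leaf     : Fin n → Fin m
    leafInj  : Injective _≡_ _≡_ leaf
    leaves   : ∀ t → IsRootedLeaf T root t ⇔ (∃[ x ] leaf x ≡ t)
    depth    : ∀ x → Dist T root (leaf x) d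
    f        : Fin n → Fin k
    coherent : ∀ x₁ y₁ x₂ y₂ ℓ →
               Dist T (leaf x₁) (leaf y₁) ℓ → Dist T (leaf x₂) (leaf y₂) ℓ →
               f x₁ ≡ f x₂ → f y₁ ≡ f y₂ →
               Edge G x₁ y₁ ⇔ Edge G x₂ y₂

SameComponent : ∀ {n m} → SimpleGraph m → (Fin n → Fin m) → Fin m →
                Fin n → Fin n → Set
SameComponent T σ v x y = ∃[ ℓ ] WalkIn T (λ t → t ≢ v) (σ x) (σ y) ℓ

UnionOfParts : ∀ {n m} → SimpleGraph m → (Fin n → Fin m) → Fin m →
               Subset n → Set
UnionOfParts T σ v X = ∀ x y → SameComponent T σ v x y → X x ≡ X y

NodeWidthLE : ∀ {n m} → SimpleGraph n → SimpleGraph m → (Fin n → Fin m) →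
              Fin m → ℕ → Set
NodeWidthLE G T σ v k = ∀ X → UnionOfParts T σ v X → CutRankLE G X k

RadiusLE : ∀ {m} → SimpleGraph m → ℕ → Set
RadiusLE T d = ∃[ c ] (∀ u → ∃[ ℓ ] (ℓ ≤ d × Walk T c u ℓ))

record Decomposition {n} (G : SimpleGraph n) (k d : ℕ) : Set where
  field
    m         : ℕ
    T         : SimpleGraph m
    isTree    : IsTree T
    internal  : ∃[ v ] ¬ IsLeaf T v
    σ         : Fin n → Fin m
    σInj      : Injective _≡_ _≡_ σ
    σSurj     : ∀ t → IsLeaf T t → ∃[ x ] σ x ≡ t
    σLeaf     : ∀ x → IsLeaf T (σ x)
    width     : ∀ v → ¬ IsLeaf T v → NodeWidthLE G T σ v k
    radius    : RadiusLE T d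

-- Induct on d.  If the root has a single child, deleting the root leaves a (k, d − 1)-shrubbery
-- (and d = 0 is impossible with two vertices).  Otherwise the shrubbery tree itself, with σ the
-- leaf map, is the decomposition.  Every node has a descendant leaf and all leaves have depth d,
-- so the root is a centre of radius d.  At a node v, a union X of components of T − v either
-- misses the component of the root, and then all leaves of X are equally far from v, or meets it,
-- and then all leaves outside X are.  A path from X to V ∖ X passes through v, so by coherence an
-- entry of the X × (V ∖ X) matrix depends only on the colour of its row (or, in the second case,
-- of its column); such a matrix has at most k distinct rows (distinct nonzero columns), hence
-- GF(2)-rank at most k.

module Submission where

open import Defs
open import Algebra.Bundles using (CommutativeRing; CommutativeMonoid)
import Algebra.Properties.CommutativeSemigroup as CommutativeSemigroupProperties
open import Data.Bool using (Bool; true; false; _∧_; not; _xor_)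
open import Data.Bool.Properties
  using (∧-assoc; ∧-comm; ∧-zeroʳ; ∧-identityʳ; ∧-distribˡ-xor; ∧-distribʳ-xor;
         xor-same; xor-identityʳ; xor-∧-commutativeRing; ∧-commutativeMonoid; ¬-not; not-injective; ⇔→≡)
  renaming (_≟_ to _≟ᵇ_)
open import Data.Empty using (⊥-elim)
open import Data.Fin using (Fin; zero; suc; toℕ; fromℕ<; inject₁; fromℕ; punchIn; punchOut)
open import Data.Fin.Properties
  using (any?; toℕ<n; toℕ-fromℕ<; punchIn-injective; punchInᵢ≢i; punchIn-punchOut) renaming (_≟_ to _≟ᶠ_)
open import Data.Nat using (ℕ; zero; suc; _+_; _⊔_; _≤_; _<_; _≤?_; z≤n; s≤s)
open import Data.Nat.Induction using (<-rec)
open import Data.Nat.Properties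
  using (≤-refl; ≤-reflexive; ≤-trans; ≤-antisym; <-≤-trans; ≤-<-trans; n≤1+n; m≤n⇒m≤1+n;
         <⇒≱; ≮⇒≥; +-comm; +-suc; +-identityʳ; +-mono-≤; +-cancelˡ-≡; m≤n+m; m≤m⊔n; m≤n⊔m)
open import Data.Product using (∃; ∃₂; _×_; _,_; proj₁; proj₂)
open import Data.Sum using (_⊎_; inj₁; inj₂)
open import Data.Unit using (⊤; tt)
open import Function using (_∘_)
open import Function.Bundles using (_⇔_; mk⇔; Equivalence)
import Function.Properties.Equivalence as ⇔
open import Relation.Nullary using (¬_; ¬?; Dec; does; yes; no; _×-dec_)
open import Relation.Nullary.Decidable using (dec-false; decidable-stable; ¬¬-excluded-middle)
open import Relation.Binary.PropositionalEquality
  using (_≡_; _≢_; refl; sym; trans; cong; cong₂; subst; subst₂; module ≡-Reasoning)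

open ≡-Reasoning

xorSum-cong : ∀ {n} {g h : Fin n → Bool} → (∀ x → g x ≡ h x) → xorSum g ≡ xorSum h
xorSum-cong {zero}  g≡h = refl
xorSum-cong {suc n} g≡h = cong₂ _xor_ (g≡h zero) (xorSum-cong (g≡h ∘ suc))

xorSum-false : ∀ {n} {g : Fin n → Bool} → (∀ x → g x ≡ false) → xorSum g ≡ false
xorSum-false {zero}  g≡false = refl
xorSum-false {suc n} g≡false = cong₂ _xor_ (g≡false zero) (xorSum-false (g≡false ∘ suc))

xorSum-xor : ∀ {n} (g h : Fin n → Bool) →
             xorSum (λ x → g x xor h x) ≡ xorSum g xor xorSum h
xorSum-xor {zero}  g h = refl
xorSum-xor {suc n} g h = begin
  (g zero xor h zero) xor xorSum (λ x → g (suc x) xor h (suc x))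
    ≡⟨ cong ((g zero xor h zero) xor_) (xorSum-xor (g ∘ suc) (h ∘ suc)) ⟩
  (g zero xor h zero) xor (xorSum (g ∘ suc) xor xorSum (h ∘ suc))
    ≡⟨ interchange (g zero) (h zero) (xorSum (g ∘ suc)) (xorSum (h ∘ suc)) ⟩
  (g zero xor xorSum (g ∘ suc)) xor (h zero xor xorSum (h ∘ suc)) ∎
  where
  open CommutativeSemigroupProperties
    (CommutativeRing.+-commutativeSemigroup xor-∧-commutativeRing) using (interchange)

xorSum-∧ˡ : ∀ {n} b (g : Fin n → Bool) → xorSum (λ x → b ∧ g x) ≡ b ∧ xorSum g
xorSum-∧ˡ true  g = refl
xorSum-∧ˡ {n} false g = xorSum-false {n} (λ _ → refl)

xorSum-∧ʳ : ∀ {n} b (g : Fin n → Bool) → xorSum (λ x → g x ∧ b) ≡ xorSum g ∧ b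
xorSum-∧ʳ b g = begin
  xorSum (λ x → g x ∧ b) ≡⟨ xorSum-cong (λ x → ∧-comm (g x) b) ⟩
  xorSum (λ x → b ∧ g x) ≡⟨ xorSum-∧ˡ b g ⟩
  b ∧ xorSum g           ≡⟨ ∧-comm b (xorSum g) ⟩
  xorSum g ∧ b           ∎

xorSum-comm : ∀ {n k} (h : Fin n → Fin k → Bool) →
              xorSum (λ x → xorSum (h x)) ≡ xorSum (λ j → xorSum (λ x → h x j))
xorSum-comm {zero} {k} h = sym (xorSum-false {k} (λ _ → refl))
xorSum-comm {suc n} h = begin
  xorSum (h zero) xor xorSum (λ x → xorSum (h (suc x)))
    ≡⟨ cong (xorSum (h zero) xor_) (xorSum-comm (h ∘ suc)) ⟩
  xorSum (h zero) xor xorSum (λ j → xorSum (λ x → h (suc x) j))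
    ≡⟨ xorSum-xor (h zero) (λ j → xorSum (λ x → h (suc x) j)) ⟨
  xorSum (λ j → xorSum (λ x → h x j)) ∎

xorSum-select : ∀ {k} (i : Fin k) (h : Fin k → Bool) → xorSum (λ j → does (i ≟ᶠ j) ∧ h j) ≡ h i
xorSum-select {suc k} zero h =
  trans (cong (h zero xor_) (xorSum-false {k} (λ _ → refl))) (xor-identityʳ (h zero))
xorSum-select (suc i) h = xorSum-select i (h ∘ suc)

card-cong : ∀ {n} {S S′ : Subset n} → (∀ x → S x ≡ S′ x) → card S ≡ card S′
card-cong {zero}                     S≡S′ = refl
card-cong {suc n} {S} {S′} S≡S′ with S zero | S′ zero | S≡S′ zero
... | true  | .true  | refl = cong suc (card-cong (S≡S′ ∘ suc))
... | false | .false | refl = card-cong (S≡S′ ∘ suc)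

card-empty : ∀ {n} {S : Subset n} → (∀ x → S x ≡ false) → card S ≡ 0
card-empty {zero}      S≡false = refl
card-empty {suc n} {S} S≡false with S zero | S≡false zero
... | false | refl = card-empty (S≡false ∘ suc)

remove : ∀ {n} → Subset n → Fin n → Subset n
remove S p x = S x ∧ not (does (p ≟ᶠ x))

remove-true : ∀ {n} (S : Subset n) {p x} → remove S p x ≡ true → S x ≡ true × p ≢ x
remove-true S {p} {x} Sx with S x | p ≟ᶠ x
... | true | no p≢x = refl , p≢x

card-remove : ∀ {n} (S : Subset n) {p} → S p ≡ true → card S ≡ suc (card (remove S p))
card-remove {suc n} S {zero} Sp with S zero
... | true = cong suc (card-cong (λ x → sym (∧-identityʳ (S (suc x)))))
card-remove {suc n} S {suc p} Sp with S zero
... | true  = cong suc (card-remove (S ∘ suc) Sp)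
... | false = card-remove (S ∘ suc) Sp

maximum : ∀ {j} → (Fin j → ℕ) → ℕ
maximum {zero}  g = 0
maximum {suc j} g = g zero ⊔ maximum (g ∘ suc)

≤-maximum : ∀ {j} (g : Fin j → ℕ) i → g i ≤ maximum g
≤-maximum g zero    = m≤m⊔n _ _
≤-maximum g (suc i) = ≤-trans (≤-maximum (g ∘ suc) i) (m≤n⊔m _ _)

-- Rank over GF(2)

true≢false : true ≢ false
true≢false ()

toggle : ∀ {n} → Subset n → Bool → Fin n → Subset n
toggle S b p x = S x xor (b ∧ does (p ≟ᶠ x))

toggle-≢ : ∀ {n} (S : Subset n) b {p x} → p ≢ x → toggle S b p x ≡ S x
toggle-≢ S b {p} {x} p≢x = begin
  S x xor (b ∧ does (p ≟ᶠ x)) ≡⟨ cong (λ z → S x xor (b ∧ z)) (dec-false (p ≟ᶠ x) p≢x) ⟩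
  S x xor (b ∧ false)         ≡⟨ cong (S x xor_) (∧-zeroʳ b) ⟩
  S x xor false               ≡⟨ xor-identityʳ (S x) ⟩
  S x                         ∎

rowSum-toggle : ∀ {r c} (M : Fin r → Fin c → Bool) S b p y →
                rowSum M (toggle S b p) y ≡ rowSum M S y xor (b ∧ M p y)
rowSum-toggle M S b p y = begin
  xorSum (λ x → (S x xor (b ∧ does (p ≟ᶠ x))) ∧ M x y)
    ≡⟨ xorSum-cong (λ x → trans (∧-distribʳ-xor (M x y) (S x) _)
                                (cong ((S x ∧ M x y) xor_) (∧-assoc b _ (M x y)))) ⟩
  xorSum (λ x → (S x ∧ M x y) xor (b ∧ (does (p ≟ᶠ x) ∧ M x y)))
    ≡⟨ xorSum-xor (λ x → S x ∧ M x y) (λ x → b ∧ (does (p ≟ᶠ x) ∧ M x y)) ⟩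
  rowSum M S y xor xorSum (λ x → b ∧ (does (p ≟ᶠ x) ∧ M x y))
    ≡⟨ cong (rowSum M S y xor_) (xorSum-∧ˡ b (λ x → does (p ≟ᶠ x) ∧ M x y)) ⟩
  rowSum M S y xor (b ∧ xorSum (λ x → does (p ≟ᶠ x) ∧ M x y))
    ≡⟨ cong (λ z → rowSum M S y xor (b ∧ z)) (xorSum-select p (λ x → M x y)) ⟩
  rowSum M S y xor (b ∧ M p y) ∎

module _ {r c : ℕ} (A : Fin r → Fin (suc c) → Bool) where

  dropFirstColumn : Fin r → Fin c → Bool
  dropFirstColumn x j = A x (suc j)

  independent-dropFirstColumn : ∀ {S} → (∀ x → S x ≡ true → A x zero ≡ false) →
                                RowsIndependent A S → RowsIndependent dropFirstColumn S
  independent-dropFirstColumn zeroColumn ind S′ S′⊆S nonempty with ind S′ S′⊆S nonempty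
  ... | suc j , sum≡true = j , sum≡true
  ... | zero  , sum≡true = ⊥-elim (true≢false (trans (sym sum≡true) (xorSum-false vanishes)))
    where
    vanishes : ∀ x → S′ x ∧ A x zero ≡ false
    vanishes x with S′ x in S′x
    ... | true  = zeroColumn x (S′⊆S x S′x)
    ... | false = refl

  -- Gaussian elimination with pivot p in the first column.
  eliminate : Fin r → Fin r → Fin c → Bool
  eliminate p x j = A x (suc j) xor (A x zero ∧ A p (suc j))

  rowSum-eliminate : ∀ p S j →
    rowSum (eliminate p) S j ≡ rowSum A S (suc j) xor (rowSum A S zero ∧ A p (suc j))
  rowSum-eliminate p S j = begin
    xorSum (λ x → S x ∧ (A x (suc j) xor (A x zero ∧ A p (suc j))))
      ≡⟨ xorSum-cong (λ x → trans (∧-distribˡ-xor (S x) _ _)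
                                  (cong ((S x ∧ A x (suc j)) xor_) (sym (∧-assoc (S x) _ _)))) ⟩
    xorSum (λ x → (S x ∧ A x (suc j)) xor ((S x ∧ A x zero) ∧ A p (suc j)))
      ≡⟨ xorSum-xor (λ x → S x ∧ A x (suc j)) (λ x → (S x ∧ A x zero) ∧ A p (suc j)) ⟩
    rowSum A S (suc j) xor xorSum (λ x → (S x ∧ A x zero) ∧ A p (suc j))
      ≡⟨ cong (rowSum A S (suc j) xor_) (xorSum-∧ʳ (A p (suc j)) (λ x → S x ∧ A x zero)) ⟩
    rowSum A S (suc j) xor (rowSum A S zero ∧ A p (suc j)) ∎

  -- Adding the pivot row p to S′ exactly when S′ sums to 1 in the first column turns
  -- a dependency of the eliminated rows into one of the original rows.
  independent-eliminate : ∀ {S p} → S p ≡ true → A p zero ≡ true →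
                          RowsIndependent A S → RowsIndependent (eliminate p) (remove S p)
  independent-eliminate {S} {p} Sp Ap ind S′ S′⊆ (x₀ , S′x₀) = column (ind S″ S″⊆S (x₀ , S″x₀))
    where
    b : Bool
    b = rowSum A S′ zero
    S″ : Subset r
    S″ = toggle S′ b p
    S″⊆S : S″ ⊆ S
    S″⊆S x S″x = byCase (p ≟ᶠ x)
      where
      byCase : Dec (p ≡ x) → S x ≡ true
      byCase (yes refl) = Sp
      byCase (no p≢x)   = proj₁ (remove-true S {p} (S′⊆ x (trans (sym (toggle-≢ S′ b p≢x)) S″x)))
    S″x₀ : S″ x₀ ≡ true
    S″x₀ = trans (toggle-≢ S′ b (proj₂ (remove-true S {p} (S′⊆ x₀ S′x₀)))) S′x₀
    firstColumn : rowSum A S″ zero ≡ false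
    firstColumn = begin
      rowSum A S″ zero       ≡⟨ rowSum-toggle A S′ b p zero ⟩
      b xor (b ∧ A p zero)   ≡⟨ cong (λ z → b xor (b ∧ z)) Ap ⟩
      b xor (b ∧ true)       ≡⟨ cong (b xor_) (∧-identityʳ b) ⟩
      b xor b                ≡⟨ xor-same b ⟩
      false                  ∎
    column : ∃ (λ y → rowSum A S″ y ≡ true) → ∃ (λ j → rowSum (eliminate p) S′ j ≡ true)
    column (zero  , sum≡true) = ⊥-elim (true≢false (trans (sym sum≡true) firstColumn))
    column (suc j , sum≡true) =
      j , trans (rowSum-eliminate p S′ j) (trans (sym (rowSum-toggle A S′ b p (suc j))) sum≡true)

card≤columns : ∀ {r} c (A : Fin r → Fin c → Bool) {S} → RowsIndependent A S → card S ≤ c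
card≤columns zero A {S} ind = ≤-reflexive (card-empty empty)
  where
  empty : ∀ x → S x ≡ false
  empty x with S x in Sx
  ... | false = refl
  ... | true with () ← proj₁ (ind S (λ _ Sy → Sy) (x , Sx))
card≤columns (suc c) A {S} ind with any? (λ p → S p ≟ᵇ true ×-dec A p zero ≟ᵇ true)
... | yes (p , Sp , Ap) =
  ≤-trans (≤-reflexive (card-remove S Sp)) (s≤s (card≤columns c _ (independent-eliminate A Sp Ap ind)))
... | no noPivot =
  m≤n⇒m≤1+n (card≤columns c _ (independent-dropFirstColumn A zeroColumn ind))
  where
  zeroColumn : ∀ x → S x ≡ true → A x zero ≡ false
  zeroColumn x Sx = ¬-not (λ Ax → noPivot (x , Sx , Ax))

module _ {r k c : ℕ} (M : Fin r → Fin c → Bool) (A : Fin r → Fin k → Bool) (B : Fin k → Fin c → Bool)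
         {S : Subset r} (factor : ∀ x → S x ≡ true → ∀ y → M x y ≡ xorSum (λ j → A x j ∧ B j y)) where

  rowSum-factor : ∀ {S′} → S′ ⊆ S → ∀ y → rowSum M S′ y ≡ xorSum (λ j → rowSum A S′ j ∧ B j y)
  rowSum-factor {S′} S′⊆S y = begin
    xorSum (λ x → S′ x ∧ M x y)                           ≡⟨ xorSum-cong restrict ⟩
    xorSum (λ x → xorSum (λ j → (S′ x ∧ A x j) ∧ B j y))  ≡⟨ xorSum-comm (λ x j → (S′ x ∧ A x j) ∧ B j y) ⟩
    xorSum (λ j → xorSum (λ x → (S′ x ∧ A x j) ∧ B j y))
      ≡⟨ xorSum-cong (λ j → xorSum-∧ʳ (B j y) (λ x → S′ x ∧ A x j)) ⟩
    xorSum (λ j → rowSum A S′ j ∧ B j y)                  ∎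
    where
    restrict : ∀ x → S′ x ∧ M x y ≡ xorSum (λ j → (S′ x ∧ A x j) ∧ B j y)
    restrict x with S′ x in S′x
    ... | true  = factor x (S′⊆S x S′x) y
    ... | false = sym (xorSum-false {k} (λ _ → refl))

  independent-factor : RowsIndependent M S → RowsIndependent A S
  independent-factor ind S′ S′⊆S nonempty with any? (λ j → rowSum A S′ j ≟ᵇ true)
  ... | yes witness = witness
  ... | no none with ind S′ S′⊆S nonempty
  ...   | y , sum≡true = ⊥-elim (true≢false (begin
    true                                 ≡⟨ sum≡true ⟨
    rowSum M S′ y                        ≡⟨ rowSum-factor S′⊆S y ⟩
    xorSum (λ j → rowSum A S′ j ∧ B j y)
      ≡⟨ xorSum-false (λ j → cong (_∧ B j y) (¬-not (λ Aj → none (j , Aj)))) ⟩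
    false                                ∎))

  card≤innerDimension : RowsIndependent M S → card S ≤ k
  card≤innerDimension ind = card≤columns k A (independent-factor ind)

-- false on colours that P misses
classValue : ∀ {n k} (P : Subset n) (f : Fin n → Fin k) (g : Fin n → Bool) → Fin k → Bool
classValue P f g j with any? (λ x → P x ≟ᵇ true ×-dec f x ≟ᶠ j)
... | yes (x , _) = g x
... | no _        = false

classValue-spec : ∀ {n k} {P : Subset n} {f : Fin n → Fin k} {g : Fin n → Bool} →
  (∀ x₁ x₂ → P x₁ ≡ true → P x₂ ≡ true → f x₁ ≡ f x₂ → g x₁ ≡ g x₂) →
  ∀ {x} → P x ≡ true → classValue P f g (f x) ≡ g x
classValue-spec {P = P} {f} constant {x} Px with any? (λ x′ → P x′ ≟ᵇ true ×-dec f x′ ≟ᶠ f x)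
... | yes (x′ , Px′ , fx′≡fx) = constant x′ x Px′ Px fx′≡fx
... | no none                 = ⊥-elim (none (x , Px , refl))

card≤colours-of-rows : ∀ {r c k} (M : Fin r → Fin c → Bool) (f : Fin r → Fin k) {S} →
  (∀ x₁ x₂ → S x₁ ≡ true → S x₂ ≡ true → f x₁ ≡ f x₂ → ∀ y → M x₁ y ≡ M x₂ y) →
  RowsIndependent M S → card S ≤ k
card≤colours-of-rows {c = c} {k} M f {S} sameRow = card≤innerDimension M (λ x j → does (f x ≟ᶠ j)) B factor
  where
  B : Fin k → Fin c → Bool
  B j y = classValue S f (λ x → M x y) j
  factor : ∀ x → S x ≡ true → ∀ y → M x y ≡ xorSum (λ j → does (f x ≟ᶠ j) ∧ B j y)
  factor x Sx y = sym (trans (xorSum-select (f x) (λ j → B j y))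
                             (classValue-spec (λ x₁ x₂ S₁ S₂ f₁≡f₂ → sameRow x₁ x₂ S₁ S₂ f₁≡f₂ y) Sx))

card≤colours-of-columns : ∀ {r c k} (M : Fin r → Fin c → Bool) (f : Fin c → Fin k) (W : Subset c) {S} →
  (∀ x → S x ≡ true → ∀ y → W y ≡ false → M x y ≡ false) →
  (∀ x → S x ≡ true → ∀ y₁ y₂ → W y₁ ≡ true → W y₂ ≡ true → f y₁ ≡ f y₂ → M x y₁ ≡ M x y₂) →
  RowsIndependent M S → card S ≤ k
card≤colours-of-columns {r} {k = k} M f W {S} zeroOutside sameColumn =
  card≤innerDimension M A (λ j y → does (f y ≟ᶠ j) ∧ W y) factor
  where
  open CommutativeSemigroupProperties
    (CommutativeMonoid.commutativeSemigroup ∧-commutativeMonoid) using (x∙yz≈y∙xz)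
  A : Fin r → Fin k → Bool
  A x = classValue W f (M x)
  factor : ∀ x → S x ≡ true → ∀ y → M x y ≡ xorSum (λ j → A x j ∧ (does (f y ≟ᶠ j) ∧ W y))
  factor x Sx y = sym (begin
    xorSum (λ j → A x j ∧ (does (f y ≟ᶠ j) ∧ W y)) ≡⟨ xorSum-cong (λ j → x∙yz≈y∙xz (A x j) _ (W y)) ⟩
    xorSum (λ j → does (f y ≟ᶠ j) ∧ (A x j ∧ W y)) ≡⟨ xorSum-select (f y) (λ j → A x j ∧ W y) ⟩
    A x (f y) ∧ W y                                ≡⟨ entry (W y) refl ⟩
    M x y                                          ∎)
    where
    entry : ∀ b → W y ≡ b → A x (f y) ∧ b ≡ M x y
    entry true  Wy = trans (∧-identityʳ _) (classValue-spec (sameColumn x Sx) Wy)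
    entry false Wy = trans (∧-zeroʳ _) (sym (zeroOutside x Sx y Wy))

-- Walks and distances

module Walks {m : ℕ} (T : SimpleGraph m) where

  edge-sym : ∀ {a b} → Edge T a b → Edge T b a
  edge-sym {a} {b} e = trans (symm T b a) e

  edge-irrefl : ∀ {a b} → Edge T a b → a ≢ b
  edge-irrefl {a} e refl = true≢false (trans (sym e) (irrefl T a))

  head : ∀ {P a b ℓ} → WalkIn T P a b ℓ → P a
  head (here Pa)     = Pa
  head (step Pa _ _) = Pa

  last : ∀ {P a b ℓ} → WalkIn T P a b ℓ → P b
  last (here Pb)     = Pb
  last (step _ _ w)  = last w

  infixr 5 _++ʷ_
  _++ʷ_ : ∀ {P a b c ℓ₁ ℓ₂} → WalkIn T P a b ℓ₁ → WalkIn T P b c ℓ₂ → WalkIn T P a c (ℓ₁ + ℓ₂)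
  here _     ++ʷ w′ = w′
  step p e w ++ʷ w′ = step p e (w ++ʷ w′)

  snoc : ∀ {P a b c ℓ} → WalkIn T P a b ℓ → Edge T b c → P c → WalkIn T P a c (suc ℓ)
  snoc {ℓ = ℓ} w e Pc = subst (WalkIn T _ _ _) (+-comm ℓ 1) (w ++ʷ step (last w) e (here Pc))

  reverse : ∀ {P a b ℓ} → WalkIn T P a b ℓ → WalkIn T P b a ℓ
  reverse (here Pa)     = here Pa
  reverse (step Pa e w) = snoc (reverse w) (edge-sym e) Pa

  forget : ∀ {P a b ℓ} → WalkIn T P a b ℓ → Walk T a b ℓ
  forget (here _)     = here tt
  forget (step _ e w) = step tt e (forget w)

  walk? : ∀ ℓ a b → Dec (Walk T a b ℓ)
  walk? zero a b with a ≟ᶠ b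
  ... | yes refl = yes (here tt)
  ... | no a≢b   = no λ { (here _) → a≢b refl }
  walk? (suc ℓ) a b with any? (λ w → adj T a w ≟ᵇ true ×-dec walk? ℓ w b)
  ... | yes (w , e , rest) = yes (step tt e rest)
  ... | no none            = no λ { (step _ e rest) → none (_ , e , rest) }

  shortest : ∀ {a b} ℓ → Walk T a b ℓ → ∃ (Dist T a b)
  shortest {a} {b} = <-rec (λ ℓ → Walk T a b ℓ → ∃ (Dist T a b)) search
    where
    search : ∀ ℓ → (∀ {ℓ′} → ℓ′ < ℓ → Walk T a b ℓ′ → ∃ (Dist T a b)) → Walk T a b ℓ → ∃ (Dist T a b)
    search ℓ rec w with any? (λ (i : Fin ℓ) → walk? (toℕ i) a b)
    ... | yes (i , shorter) = rec (toℕ<n i) shorter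
    ... | no none           = ℓ , w , λ ℓ′ ℓ′<ℓ w′ →
      none (fromℕ< ℓ′<ℓ , subst (Walk T a b) (sym (toℕ-fromℕ< ℓ′<ℓ)) w′)

  distance : Connected T → ∀ a b → ∃ (Dist T a b)
  distance connected a b = shortest _ (proj₂ (connected a b))

  Dist⇒≤ : ∀ {a b p ℓ} → Dist T a b p → Walk T a b ℓ → p ≤ ℓ
  Dist⇒≤ (_ , minimal) w = ≮⇒≥ (λ ℓ<p → minimal _ ℓ<p w)

  Dist-unique : ∀ {a b p q} → Dist T a b p → Dist T a b q → p ≡ q
  Dist-unique dp dq = ≤-antisym (Dist⇒≤ dp (proj₁ dq)) (Dist⇒≤ dq (proj₁ dp))

  Dist-sym : ∀ {a b p} → Dist T a b p → Dist T b a p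
  Dist-sym (w , minimal) = reverse w , λ ℓ ℓ<p w′ → minimal ℓ ℓ<p (reverse w′)

  Dist-edge : ∀ {a b} → Edge T a b → Dist T a b 1
  Dist-edge e = step tt e (here tt) , λ { zero _ (here _) → edge-irrefl e refl ; (suc _) (s≤s ()) _ }

  avoid-or-through : ∀ v {a b ℓ} → Walk T a b ℓ →
    WalkIn T (_≢ v) a b ℓ ⊎ ∃₂ λ ℓ₁ ℓ₂ → Walk T a v ℓ₁ × Walk T v b ℓ₂ × ℓ₁ + ℓ₂ ≡ ℓ
  avoid-or-through v {a} w with a ≟ᶠ v
  avoid-or-through v (here _)             | yes refl = inj₂ (0 , 0 , here tt , here tt , refl)
  avoid-or-through v (step {ℓ = ℓ} _ e w) | yes refl = inj₂ (0 , suc ℓ , here tt , step tt e w , refl)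
  avoid-or-through v (here _)             | no a≢v   = inj₁ (here a≢v)
  avoid-or-through v (step _ e w)         | no a≢v with avoid-or-through v w
  ... | inj₁ w′                          = inj₁ (step a≢v e w′)
  ... | inj₂ (ℓ₁ , ℓ₂ , w₁ , w₂ , ℓ₁+ℓ₂) = inj₂ (suc ℓ₁ , ℓ₂ , step tt e w₁ , w₂ , cong suc ℓ₁+ℓ₂)

  Separates : Fin m → Fin m → Fin m → Set
  Separates v a b = ∀ ℓ → ¬ WalkIn T (_≢ v) a b ℓ

  Dist-through : ∀ {v a b p q} → Separates v a b → Dist T a v p → Dist T v b q → Dist T a b (p + q)
  Dist-through {v} separates dp dq = proj₁ dp ++ʷ proj₁ dq , minimal
    where
    minimal : ∀ ℓ → ℓ < _ → ¬ Walk T _ _ ℓ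
    minimal ℓ ℓ<p+q w with avoid-or-through v w
    ... | inj₁ w′ = separates ℓ w′
    ... | inj₂ (ℓ₁ , ℓ₂ , w₁ , w₂ , refl) = <⇒≱ ℓ<p+q (+-mono-≤ (Dist⇒≤ dp w₁) (Dist⇒≤ dq w₂))

-- Paths and cycles

module Paths {m : ℕ} (T : SimpleGraph m) where
  open Walks T

  infix 4 _∈ʷ_
  _∈ʷ_ : ∀ {P a b ℓ} → Fin m → WalkIn T P a b ℓ → Set
  x ∈ʷ here {u} _     = x ≡ u
  x ∈ʷ step {u} _ _ w = x ≡ u ⊎ x ∈ʷ w

  _∈ʷ?_ : ∀ {P a b ℓ} x (w : WalkIn T P a b ℓ) → Dec (x ∈ʷ w)
  x ∈ʷ? here {u} _ = x ≟ᶠ u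
  x ∈ʷ? step {u} _ _ w with x ≟ᶠ u | x ∈ʷ? w
  ... | yes x≡u | _       = yes (inj₁ x≡u)
  ... | no _    | yes x∈w = yes (inj₂ x∈w)
  ... | no x≢u  | no x∉w  = no λ { (inj₁ x≡u) → x≢u x≡u ; (inj₂ x∈w) → x∉w x∈w }

  Distinct : ∀ {P a b ℓ} → WalkIn T P a b ℓ → Set
  Distinct (here _)         = ⊤
  Distinct (step {u} _ _ w) = ¬ u ∈ʷ w × Distinct w

  record Path (P : Fin m → Set) (a b : Fin m) : Set where
    constructor path
    field
      {len}    : ℕ
      walk     : WalkIn T P a b len
      distinct : Distinct walk

  suffix : ∀ {P a b ℓ x} (w : WalkIn T P a b ℓ) → Distinct w → x ∈ʷ w → Path P x b
  suffix (here Pa)       _        refl       = path (here Pa) tt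
  suffix w@(step _ _ _)  dw       (inj₁ refl) = path w dw
  suffix (step _ _ w)    (_ , dw) (inj₂ x∈w) = suffix w dw x∈w

  loop-erase : ∀ {P a b ℓ} → WalkIn T P a b ℓ → Path P a b
  loop-erase (here Pa) = path (here Pa) tt
  loop-erase {a = a} (step Pa e w) with loop-erase w
  ... | path w′ dw′ with a ∈ʷ? w′
  ...   | yes a∈w′ = suffix w′ dw′ a∈w′
  ...   | no a∉w′  = path (step Pa e w′) (a∉w′ , dw′)

  vertex : ∀ {P a b ℓ} → WalkIn T P a b ℓ → Fin (suc ℓ) → Fin m
  vertex {a = a} w            zero    = a
  vertex         (step _ _ w) (suc i) = vertex w i

  vertex-last : ∀ {P a b ℓ} (w : WalkIn T P a b ℓ) → vertex w (fromℕ ℓ) ≡ b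
  vertex-last (here _)     = refl
  vertex-last (step _ _ w) = vertex-last w

  vertex-edge : ∀ {P a b ℓ} (w : WalkIn T P a b ℓ) i → Edge T (vertex w (inject₁ i)) (vertex w (suc i))
  vertex-edge (step _ e w) zero    = e
  vertex-edge (step _ _ w) (suc i) = vertex-edge w i

  vertex-satisfies : ∀ {P a b ℓ} (w : WalkIn T P a b ℓ) i → P (vertex w i)
  vertex-satisfies w            zero    = head w
  vertex-satisfies (step _ _ w) (suc i) = vertex-satisfies w i

  vertex-∈ : ∀ {P a b ℓ} (w : WalkIn T P a b ℓ) i → vertex w i ∈ʷ w
  vertex-∈ (here _)     zero    = refl
  vertex-∈ (step _ _ w) zero    = inj₁ refl
  vertex-∈ (step _ _ w) (suc i) = inj₂ (vertex-∈ w i)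

  vertex-injective : ∀ {P a b ℓ} (w : WalkIn T P a b ℓ) → Distinct w →
                     ∀ {i j} → vertex w i ≡ vertex w j → i ≡ j
  vertex-injective w            _          {zero}  {zero}  _  = refl
  vertex-injective (step _ _ w) (a∉w , _)  {zero}  {suc j} eq =
    ⊥-elim (a∉w (subst (_∈ʷ w) (sym eq) (vertex-∈ w j)))
  vertex-injective (step _ _ w) (a∉w , _)  {suc i} {zero}  eq = ⊥-elim (a∉w (subst (_∈ʷ w) eq (vertex-∈ w i)))
  vertex-injective (step _ _ w) (_ , dw)   {suc i} {suc j} eq = cong suc (vertex-injective w dw eq)

  -- u followed by a path from w₁ to w₀ avoiding u closes up to a cycle.
  acyclic⇒separates : Acyclic T → ∀ {u w₁ w₀} → Edge T u w₁ → Edge T w₀ u → w₁ ≢ w₀ →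
                      Separates u w₁ w₀
  acyclic⇒separates acyclic {u} e₁ e₀ w₁≢w₀ ℓ w with loop-erase w
  ... | path {zero}  (here _) _  = w₁≢w₀ refl
  ... | path {suc L} p        dp = acyclic record
    { len = L ; vert = vert ; inj = inj ; consec = consec ; close = close }
    where
    vert : Fin (suc (suc (suc L))) → Fin m
    vert zero    = u
    vert (suc i) = vertex p i
    inj : ∀ {i j} → vert i ≡ vert j → i ≡ j
    inj {zero}  {zero}  _  = refl
    inj {zero}  {suc j} eq = ⊥-elim (vertex-satisfies p j (sym eq))
    inj {suc i} {zero}  eq = ⊥-elim (vertex-satisfies p i eq)
    inj {suc i} {suc j} eq = cong suc (vertex-injective p dp eq)
    consec : ∀ i → Edge T (vert (inject₁ i)) (vert (suc i))
    consec zero    = e₁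
    consec (suc i) = vertex-edge p i
    close : Edge T (vert (fromℕ (suc (suc L)))) u
    close = subst (λ z → Edge T z u) (sym (vertex-last p)) e₀

-- Leaves, and deletion of a pendant vertex

IsRootedLeaf-root : ∀ {m} (T : SimpleGraph m) {r} → IsRootedLeaf T r r ⇔ DegreeZero T r
IsRootedLeaf-root T = mk⇔ to (λ isolated → inj₂ (refl , isolated))
  where
  to : ∀ {r} → IsRootedLeaf T r r → DegreeZero T r
  to (inj₁ (r≢r , _))      = ⊥-elim (r≢r refl)
  to (inj₂ (_ , isolated)) = isolated

IsRootedLeaf-nonroot : ∀ {m} (T : SimpleGraph m) {r t} → t ≢ r → IsRootedLeaf T r t ⇔ DegreeOne T t
IsRootedLeaf-nonroot T t≢r = mk⇔ to (λ pendant → inj₁ (t≢r , pendant))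
  where
  to : IsRootedLeaf T _ _ → DegreeOne T _
  to (inj₁ (_ , pendant)) = pendant
  to (inj₂ (t≡r , _))     = ⊥-elim (t≢r t≡r)

module PendantDeletion {m : ℕ} (T : SimpleGraph (suc m)) (r c : Fin (suc m))
                       (r—c : Edge T r c) (only-c : ∀ w → Edge T r w → w ≡ c) where
  open Walks T

  embed : Fin m → Fin (suc m)
  embed = punchIn r

  T⁻ : SimpleGraph m
  T⁻ = record
    { adj    = λ i j → adj T (embed i) (embed j)
    ; symm   = λ i j → symm T (embed i) (embed j)
    ; irrefl = λ i → irrefl T (embed i)
    }

  embed≢r : ∀ a → embed a ≢ r
  embed≢r = punchInᵢ≢i r

  embed-injective : ∀ {a b} → embed a ≡ embed b → a ≡ b
  embed-injective = punchIn-injective r _ _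

  restrict : ∀ {s} → s ≢ r → Fin m
  restrict s≢r = punchOut (s≢r ∘ sym)

  embed-restrict : ∀ {s} (s≢r : s ≢ r) → embed (restrict s≢r) ≡ s
  embed-restrict s≢r = punchIn-punchOut (s≢r ∘ sym)

  restrict-embed : ∀ {a} (p : embed a ≢ r) → restrict p ≡ a
  restrict-embed p = embed-injective (embed-restrict p)

  c≢r : c ≢ r
  c≢r c≡r = edge-irrefl r—c (sym c≡r)

  c⁻ : Fin m
  c⁻ = restrict c≢r

  neighbour-of-r : ∀ {u} → Edge T u r → u ≡ c
  neighbour-of-r e = only-c _ (edge-sym e)

  lift : ∀ {a b ℓ} → Walk T⁻ a b ℓ → Walk T (embed a) (embed b) ℓ
  lift (here _)     = here tt
  lift (step _ e w) = step tt e (lift w)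

  lower : ∀ {s t ℓ} (w : WalkIn T (_≢ r) s t ℓ) → Walk T⁻ (restrict (head w)) (restrict (last w)) ℓ
  lower (here _)       = here tt
  lower (step s≢r e w) =
    step tt (trans (cong₂ (adj T) (embed-restrict s≢r) (embed-restrict (head w))) e) (lower w)

  lower-embed : ∀ {a b ℓ} → WalkIn T (_≢ r) (embed a) (embed b) ℓ → Walk T⁻ a b ℓ
  lower-embed w = subst₂ (λ a b → Walk T⁻ a b _) (restrict-embed (head w)) (restrict-embed (last w)) (lower w)

  -- A detour into r must come from c and go straight back to c.
  shortcut : ∀ {s t ℓ} → Walk T s t ℓ → s ≢ r → t ≢ r →
             ∃ λ ℓ′ → ℓ′ ≤ ℓ × WalkIn T (_≢ r) s t ℓ′
  shortcut (here _)               s≢r t≢r = 0 , z≤n , here s≢r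
  shortcut (step {w = w} _ e rest) s≢r t≢r with w ≟ᶠ r
  ... | no w≢r with shortcut rest w≢r t≢r
  ...   | ℓ′ , ℓ′≤ , rest′ = suc ℓ′ , s≤s ℓ′≤ , step s≢r e rest′
  shortcut (step _ e (here _))               s≢r t≢r | yes refl = ⊥-elim (t≢r refl)
  shortcut (step _ e (step _ e′ rest))       s≢r t≢r | yes refl
    with refl ← trans (only-c _ e′) (sym (neighbour-of-r e)) with shortcut rest s≢r t≢r
  ... | ℓ′ , ℓ′≤ , rest′ = ℓ′ , ≤-trans ℓ′≤ (≤-trans (n≤1+n _) (n≤1+n _)) , rest′

  Dist-embed : ∀ {a b ℓ} → Dist T⁻ a b ℓ → Dist T (embed a) (embed b) ℓ
  Dist-embed {a} {b} (w , minimal) = lift w , λ ℓ′ ℓ′<ℓ w′ →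
    let (ℓ″ , ℓ″≤ℓ′ , w″) = shortcut w′ (embed≢r a) (embed≢r b)
    in  minimal ℓ″ (≤-<-trans ℓ″≤ℓ′ ℓ′<ℓ) (lower-embed w″)

  Dist-restrict : ∀ {a b ℓ} → Dist T (embed a) (embed b) ℓ → Dist T⁻ a b ℓ
  Dist-restrict {a} {b} {ℓ} d@(w , minimal) with shortcut w (embed≢r a) (embed≢r b)
  ... | ℓ′ , ℓ′≤ℓ , w′ = subst (Dist T⁻ a b) (≤-antisym ℓ′≤ℓ (Dist⇒≤ d (forget w′)))
    (lower-embed w′ , λ ℓ″ ℓ″<ℓ′ w″ → minimal ℓ″ (<-≤-trans ℓ″<ℓ′ ℓ′≤ℓ) (lift w″))

  isTree⁻ : IsTree T → IsTree T⁻
  isTree⁻ (connected , acyclic) = connected⁻ , acyclic⁻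
    where
    connected⁻ : Connected T⁻
    connected⁻ a b =
      let (ℓ′ , _ , w′) = shortcut (proj₂ (connected (embed a) (embed b))) (embed≢r a) (embed≢r b)
      in  ℓ′ , lower-embed w′
    acyclic⁻ : Acyclic T⁻
    acyclic⁻ C = acyclic record
      { len = Cycle.len C ; vert = embed ∘ Cycle.vert C ; inj = Cycle.inj C ∘ embed-injective
      ; consec = Cycle.consec C ; close = Cycle.close C }

  DegreeOne⁻⇔ : ∀ {t} → embed t ≢ c → DegreeOne T⁻ t ⇔ DegreeOne T (embed t)
  DegreeOne⁻⇔ {t} t≢c = mk⇔ to from
    where
    to : DegreeOne T⁻ t → DegreeOne T (embed t)
    to (u , e , unique) = embed u , e , λ w e′ → case (w ≟ᶠ r) e′
      where
      case : ∀ {w} → Dec (w ≡ r) → Edge T (embed t) w → w ≡ embed u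
      case (yes refl) e′ = ⊥-elim (t≢c (neighbour-of-r e′))
      case (no w≢r)   e′ = trans (sym (embed-restrict w≢r))
        (cong embed (unique _ (subst (Edge T (embed t)) (sym (embed-restrict w≢r)) e′)))
    from : DegreeOne T (embed t) → DegreeOne T⁻ t
    from (u , e , unique) = restrict u≢r , subst (Edge T (embed t)) (sym (embed-restrict u≢r)) e ,
      λ w e′ → embed-injective (trans (unique (embed w) e′) (sym (embed-restrict u≢r)))
      where
      u≢r : u ≢ r
      u≢r refl = t≢c (neighbour-of-r e)

  DegreeZero⁻⇔ : DegreeZero T⁻ c⁻ ⇔ DegreeOne T c
  DegreeZero⁻⇔ = mk⇔ to from
    where
    to : DegreeZero T⁻ c⁻ → DegreeOne T c
    to isolated = r , edge-sym r—c , λ w e → case (w ≟ᶠ r) e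
      where
      case : ∀ {w} → Dec (w ≡ r) → Edge T c w → w ≡ r
      case (yes w≡r) _ = w≡r
      case (no w≢r)  e = ⊥-elim (true≢false (trans (sym e) (trans
        (cong₂ (adj T) (sym (embed-restrict c≢r)) (sym (embed-restrict w≢r))) (isolated (restrict w≢r)))))
    from : DegreeOne T c → DegreeZero T⁻ c⁻
    from (u , _ , unique) w = ¬-not λ e →
      embed≢r w (trans (unique (embed w) (c—w e)) (sym (unique r (edge-sym r—c))))
      where
      c—w : Edge T⁻ c⁻ w → Edge T c (embed w)
      c—w e = subst (λ z → Edge T z (embed w)) (embed-restrict c≢r) e

  IsRootedLeaf⁻⇔ : ∀ t → IsRootedLeaf T⁻ c⁻ t ⇔ IsRootedLeaf T r (embed t)
  IsRootedLeaf⁻⇔ t = ⇔.trans (byCase (t ≟ᶠ c⁻)) (⇔.sym (IsRootedLeaf-nonroot T (embed≢r t)))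
    where
    byCase : Dec (t ≡ c⁻) → IsRootedLeaf T⁻ c⁻ t ⇔ DegreeOne T (embed t)
    byCase (yes refl) = ⇔.trans (IsRootedLeaf-root T⁻)
      (subst (λ z → DegreeZero T⁻ c⁻ ⇔ DegreeOne T z) (sym (embed-restrict c≢r)) DegreeZero⁻⇔)
    byCase (no t≢c⁻)  = ⇔.trans (IsRootedLeaf-nonroot T⁻ t≢c⁻)
      (DegreeOne⁻⇔ (λ e → t≢c⁻ (embed-injective (trans e (sym (embed-restrict c≢r))))))

-- Shrubberies

cutMatrix-inside : ∀ {n} (G : SimpleGraph n) X x {y} → X y ≡ true → cutMatrix G X x y ≡ false
cutMatrix-inside G X x {y} Xy = trans (cong (λ b → adj G x y ∧ not b) Xy) (∧-zeroʳ (adj G x y))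

module ShrubberyProperties {n} {G : SimpleGraph n} {k d : ℕ} (Sh : Shrubbery G k d) where
  open Shrubbery Sh
  open Walks T

  connected : Connected T
  connected = proj₁ isTree

  adj-coherent : ∀ {x₁ y₁ x₂ y₂ ℓ} → Dist T (leaf x₁) (leaf y₁) ℓ → Dist T (leaf x₂) (leaf y₂) ℓ →
                 f x₁ ≡ f x₂ → f y₁ ≡ f y₂ → adj G x₁ y₁ ≡ adj G x₂ y₂
  adj-coherent d₁ d₂ f₁ f₂ = ⇔→≡ (coherent _ _ _ _ _ d₁ d₂ f₁ f₂)

  module Cut (v : Fin m) where

    RootSide : Fin n → Set
    RootSide x = ∃ λ ℓ → WalkIn T (_≢ v) root (leaf x) ℓ

    height : Fin n → ℕ
    height x = proj₁ (distance connected v (leaf x))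

    Dist-height : ∀ x → Dist T v (leaf x) (height x)
    Dist-height x = proj₂ (distance connected v (leaf x))

    height-offRoot : ∀ {x} → ¬ RootSide x → proj₁ (distance connected root v) + height x ≡ d
    height-offRoot {x} x∉ = Dist-unique
      (Dist-through (λ ℓ w → x∉ (ℓ , w)) (proj₂ (distance connected root v)) (Dist-height x)) (depth x)

    height-offRoot-unique : ∀ {x₁ x₂} → ¬ RootSide x₁ → ¬ RootSide x₂ → height x₁ ≡ height x₂
    height-offRoot-unique x₁∉ x₂∉ =
      +-cancelˡ-≡ _ _ _ (trans (height-offRoot x₁∉) (sym (height-offRoot x₂∉)))

    module _ {X : Subset n} (parts : UnionOfParts T leaf v X) where

      Dist-across : ∀ {x y} → X x ≡ true → X y ≡ false → Dist T (leaf x) (leaf y) (height x + height y)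
      Dist-across Xx Xy = Dist-through separated (Dist-sym (Dist-height _)) (Dist-height _)
        where
        separated : Separates v _ _
        separated ℓ w = true≢false (trans (sym Xx) (trans (parts _ _ (ℓ , w)) Xy))

      cutMatrix-coherent : ∀ {x₁ y₁ x₂ y₂} → X x₁ ≡ true → X x₂ ≡ true → X y₁ ≡ false → X y₂ ≡ false →
        height x₁ + height y₁ ≡ height x₂ + height y₂ → f x₁ ≡ f x₂ → f y₁ ≡ f y₂ →
        cutMatrix G X x₁ y₁ ≡ cutMatrix G X x₂ y₂
      cutMatrix-coherent X₁ X₂ Y₁ Y₂ h₁≡h₂ f₁ f₂ = cong₂ (λ a b → a ∧ not b)
        (adj-coherent (Dist-across X₁ Y₁) (subst (Dist T _ _) (sym h₁≡h₂) (Dist-across X₂ Y₂)) f₁ f₂)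
        (trans Y₁ (sym Y₂))

      card≤-rootSideFree : (∀ z → X z ≡ true → ¬ RootSide z) → ∀ {S} → S ⊆ X →
                           RowsIndependent (cutMatrix G X) S → card S ≤ k
      card≤-rootSideFree X∉ {S} S⊆X = card≤colours-of-rows (cutMatrix G X) f sameRow
        where
        sameRow : ∀ x₁ x₂ → S x₁ ≡ true → S x₂ ≡ true → f x₁ ≡ f x₂ → ∀ y →
                  cutMatrix G X x₁ y ≡ cutMatrix G X x₂ y
        sameRow x₁ x₂ S₁ S₂ f₁≡f₂ y = byCase (X y) refl
          where
          X₁ = S⊆X x₁ S₁
          X₂ = S⊆X x₂ S₂
          byCase : ∀ b → X y ≡ b → cutMatrix G X x₁ y ≡ cutMatrix G X x₂ y
          byCase true  Xy = trans (cutMatrix-inside G X x₁ Xy) (sym (cutMatrix-inside G X x₂ Xy))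
          byCase false Xy = cutMatrix-coherent X₁ X₂ Xy Xy
            (cong (_+ height y) (height-offRoot-unique (X∉ x₁ X₁) (X∉ x₂ X₂))) f₁≡f₂ refl

      card≤-rootSideMet : (∃ λ z → X z ≡ true × RootSide z) → ∀ {S} → S ⊆ X →
                          RowsIndependent (cutMatrix G X) S → card S ≤ k
      card≤-rootSideMet (z , Xz , ℓ , root⇝z) {S} S⊆X =
        card≤colours-of-columns (cutMatrix G X) f (not ∘ X) zeroInside sameColumn
        where
        offRoot : ∀ {y} → X y ≡ false → ¬ RootSide y
        offRoot Xy (ℓ′ , root⇝y) =
          true≢false (trans (sym Xz) (trans (parts _ _ (_ , reverse root⇝z ++ʷ root⇝y)) Xy))
        zeroInside : ∀ x → S x ≡ true → ∀ y → not (X y) ≡ false → cutMatrix G X x y ≡ false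
        zeroInside x _ y ¬Xy = cutMatrix-inside G X x (not-injective ¬Xy)
        sameColumn : ∀ x → S x ≡ true → ∀ y₁ y₂ → not (X y₁) ≡ true → not (X y₂) ≡ true → f y₁ ≡ f y₂ →
                     cutMatrix G X x y₁ ≡ cutMatrix G X x y₂
        sameColumn x Sx y₁ y₂ ¬Y₁ ¬Y₂ f₁≡f₂ = cutMatrix-coherent (S⊆X x Sx) (S⊆X x Sx) Y₁ Y₂
          (cong (height x +_) (height-offRoot-unique (offRoot Y₁) (offRoot Y₂))) refl f₁≡f₂
          where
          Y₁ = not-injective ¬Y₁
          Y₂ = not-injective ¬Y₂

    -- Meeting the root side is not decidable as stated; the goal is, so excluded middle is available.
    width : ∀ X → UnionOfParts T leaf v X → CutRankLE G X k
    width X parts S S⊆X ind = decidable-stable (card S ≤? k) λ ≰ → ¬¬-excluded-middle λ meets? →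
      ≰ (byCase meets?)
      where
      byCase : Dec (∃ λ z → X z ≡ true × RootSide z) → card S ≤ k
      byCase (yes met) = card≤-rootSideMet parts met S⊆X ind
      byCase (no none) = card≤-rootSideFree parts (λ z Xz z∈ → none (z , Xz , z∈)) S⊆X ind

  open Paths T using (acyclic⇒separates)

  parent : ∀ {u p} → Dist T root u (suc p) → ∃ λ w → Edge T u w × ∃ λ ℓ → WalkIn T (_≢ u) w root ℓ
  parent {u} {p} Dp with reverse (proj₁ Dp)
  ... | step _ e rest with avoid-or-through u rest
  ...   | inj₁ avoiding = _ , e , p , avoiding
  ...   | inj₂ (ℓ₁ , ℓ₂ , _ , u⇝root , ℓ₁+ℓ₂≡p) =
    ⊥-elim (<⇒≱ (s≤s (subst (ℓ₂ ≤_) ℓ₁+ℓ₂≡p (m≤n+m ℓ₂ ℓ₁))) (Dist⇒≤ Dp (reverse u⇝root)))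

  child-deeper : ∀ {u p w₀ w₁} → Dist T root u p → Edge T u w₀ → (∃ λ ℓ → WalkIn T (_≢ u) w₀ root ℓ) →
                 Edge T u w₁ → w₁ ≢ w₀ → Dist T root w₁ (suc p)
  child-deeper {p = p} Dp e₀ (_ , w₀⇝root) e₁ w₁≢w₀ =
    subst (Dist T root _) (+-comm p 1) (Dist-through separated Dp (Dist-edge e₁))
    where
    separated : Separates _ root _
    separated ℓ root⇝w₁ =
      acyclic⇒separates (proj₂ isTree) e₁ (edge-sym e₀) w₁≢w₀ _ (reverse root⇝w₁ ++ʷ reverse w₀⇝root)

  leaf-or-deeper : ∀ {u p} → u ≢ root → Dist T root u p → p ≡ d ⊎ ∃ λ w → w ≢ root × Dist T root w (suc p)
  leaf-or-deeper {p = zero} u≢root (here _ , _) = ⊥-elim (u≢root refl)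
  leaf-or-deeper {u} {suc p} u≢root Dp with parent Dp
  ... | w₀ , e₀ , w₀⇝root with any? (λ w → adj T u w ≟ᵇ true ×-dec ¬? (w ≟ᶠ w₀))
  ...   | yes (w₁ , e₁ , w₁≢w₀) = inj₂ (w₁ , w₁≢root , Dw₁)
    where
    Dw₁ = child-deeper Dp e₀ w₀⇝root e₁ w₁≢w₀
    w₁≢root : w₁ ≢ root
    w₁≢root refl = <⇒≱ (s≤s z≤n) (Dist⇒≤ Dw₁ (here tt))
  ...   | no noOther with Equivalence.to (leaves u) (inj₁ (u≢root , w₀ , e₀ , onlyParent))
    where
    onlyParent : ∀ w → Edge T u w → w ≡ w₀
    onlyParent w e with w ≟ᶠ w₀
    ... | yes w≡w₀ = w≡w₀
    ... | no w≢w₀  = ⊥-elim (noOther (w , e , w≢w₀))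
  ...     | x , refl = inj₁ (Dist-unique Dp (depth x))

  maxDepth : ℕ
  maxDepth = maximum (λ w → proj₁ (distance connected root w))

  depth≤maxDepth : ∀ {w p} → Dist T root w p → p ≤ maxDepth
  depth≤maxDepth {w} Dp = subst (_≤ maxDepth) (Dist-unique (proj₂ (distance connected root w)) Dp)
                                (≤-maximum (λ w → proj₁ (distance connected root w)) w)

  -- Repeatedly stepping to a deeper neighbour must stop at a leaf, as all depths are ≤ maxDepth.
  descend : ∀ fuel {u p} → u ≢ root → Dist T root u p → maxDepth ≤ p + fuel → p ≤ d
  descend fuel u≢root Dp bound with leaf-or-deeper u≢root Dp
  ... | inj₁ p≡d = ≤-reflexive p≡d
  descend zero       {p = p} _ _ bound | inj₂ (_ , _ , Dw) =
    ⊥-elim (<⇒≱ (≤-trans (depth≤maxDepth Dw) (≤-trans bound (≤-reflexive (+-identityʳ p)))) ≤-refl)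
  descend (suc fuel) {p = p} _ _ bound | inj₂ (_ , w≢root , Dw) =
    ≤-trans (n≤1+n p) (descend fuel w≢root Dw (≤-trans bound (≤-reflexive (+-suc p fuel))))

  radius : RadiusLE T d
  radius = root , within
    where
    within : ∀ u → ∃ λ ℓ → ℓ ≤ d × Walk T root u ℓ
    within u with u ≟ᶠ root
    ... | yes refl  = 0 , z≤n , here tt
    ... | no u≢root = let (p , Dp) = distance connected root u in
                      p , descend maxDepth u≢root Dp (m≤n+m maxDepth p) , proj₁ Dp

  leaf≢root-or-isolated : ∀ x → leaf x ≢ root ⊎ DegreeZero T root
  leaf≢root-or-isolated x with Equivalence.from (leaves (leaf x)) (x , refl)
  ... | inj₁ (leaf≢root , _)    = inj₁ leaf≢root
  ... | inj₂ (refl , isolated) = inj₂ isolated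

  decomposition-of-branching : ∀ {c₁ c₂} → Edge T root c₁ → Edge T root c₂ → c₁ ≢ c₂ → Decomposition G k d
  decomposition-of-branching {c₁} {c₂} r—c₁ r—c₂ c₁≢c₂ = record
    { m = m ; T = T ; isTree = isTree ; internal = root , root-internal
    ; σ = leaf ; σInj = leafInj ; σSurj = onto ; σLeaf = leaf-pendant
    ; width = λ v _ → Cut.width v ; radius = radius }
    where
    root-internal : ¬ IsLeaf T root
    root-internal (_ , _ , unique) = c₁≢c₂ (trans (unique c₁ r—c₁) (sym (unique c₂ r—c₂)))
    onto : ∀ t → IsLeaf T t → ∃ λ x → leaf x ≡ t
    onto t pendant with t ≟ᶠ root
    ... | yes refl   = ⊥-elim (root-internal pendant)
    ... | no t≢root  = Equivalence.to (leaves t) (inj₁ (t≢root , pendant))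
    leaf-pendant : ∀ x → IsLeaf T (leaf x)
    leaf-pendant x with leaf≢root-or-isolated x
    ... | inj₁ leaf≢root =
      Equivalence.to (IsRootedLeaf-nonroot T leaf≢root) (Equivalence.from (leaves (leaf x)) (x , refl))
    ... | inj₂ isolated  = ⊥-elim (true≢false (trans (sym r—c₁) (isolated c₁)))

  branching-or-pendant : ∀ {c} → Edge T root c →
    (∃ λ c′ → Edge T root c′ × c ≢ c′) ⊎ (∀ w → Edge T root w → w ≡ c)
  branching-or-pendant {c} r—c with any? (λ w → adj T root w ≟ᵇ true ×-dec ¬? (c ≟ᶠ w))
  ... | yes other = inj₁ other
  ... | no none   = inj₂ λ w r—w → decidable-stable (w ≟ᶠ c) λ w≢c → none (w , r—w , λ c≡w → w≢c (sym c≡w))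

Shrubbery-depthZero-trivial : ∀ {n} {G : SimpleGraph n} {k} → Shrubbery G k 0 → ∀ (x y : Fin n) → x ≡ y
Shrubbery-depthZero-trivial Sh x y = leafInj (trans (at-root x) (sym (at-root y)))
  where
  open Shrubbery Sh
  at-root : ∀ x → leaf x ≡ root
  at-root x with depth x
  ... | here _ , _ = refl

Shrubbery-rootChild : ∀ {n} {G : SimpleGraph n} {k d} (Sh : Shrubbery G k (suc d)) → Fin n →
                      ∃ λ c → Edge (Shrubbery.T Sh) (Shrubbery.root Sh) c
Shrubbery-rootChild Sh x with Shrubbery.depth Sh x
... | step _ e _ , _ = _ , e

Shrubbery-deleteRoot : ∀ {n} {G : SimpleGraph n} {k d} (Sh : Shrubbery G k (suc d)) {c} →
  Edge (Shrubbery.T Sh) (Shrubbery.root Sh) c → (∀ w → Edge (Shrubbery.T Sh) (Shrubbery.root Sh) w → w ≡ c) →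
  Shrubbery G k d
Shrubbery-deleteRoot record { m = zero ; root = () }
Shrubbery-deleteRoot {G = G} {k} {d} Sh@record { m = suc m } {c} r—c only-c = record
  { m = m ; T = T⁻ ; isTree = isTree⁻ isTree ; root = c⁻ ; leaf = leaf⁻ ; leafInj = leafInj⁻
  ; leaves = leaves⁻ ; depth = depth⁻ ; f = f ; coherent = coherent⁻ }
  where
  open Shrubbery Sh hiding (m)
  open Walks T using (Dist⇒≤)
  open PendantDeletion T root c r—c only-c

  leaf≢root : ∀ x → leaf x ≢ root
  leaf≢root x leaf≡root =
    <⇒≱ (s≤s z≤n) (Dist⇒≤ (depth x) (subst (λ z → Walk T root z 0) (sym leaf≡root) (here tt)))

  leaf⁻ : Fin _ → Fin m
  leaf⁻ x = restrict (leaf≢root x)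

  embed-leaf⁻ : ∀ x → embed (leaf⁻ x) ≡ leaf x
  embed-leaf⁻ x = embed-restrict (leaf≢root x)

  leafInj⁻ : ∀ {x y} → leaf⁻ x ≡ leaf⁻ y → x ≡ y
  leafInj⁻ {x} {y} eq = leafInj (trans (sym (embed-leaf⁻ x)) (trans (cong embed eq) (embed-leaf⁻ y)))

  leaves⁻ : ∀ t → IsRootedLeaf T⁻ c⁻ t ⇔ (∃ λ x → leaf⁻ x ≡ t)
  leaves⁻ t = ⇔.trans (IsRootedLeaf⁻⇔ t) (⇔.trans (leaves (embed t)) (mk⇔
    (λ (x , leaf≡) → x , embed-injective (trans (embed-leaf⁻ x) leaf≡))
    (λ { (x , refl) → x , sym (embed-leaf⁻ x) })))

  Dist-fromChild : ∀ x → Dist T c (leaf x) d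
  Dist-fromChild x with depth x
  ... | step _ e w , minimal with refl ← only-c _ e =
    w , λ ℓ ℓ<d w′ → minimal (suc ℓ) (s≤s ℓ<d) (step tt r—c w′)

  depth⁻ : ∀ x → Dist T⁻ c⁻ (leaf⁻ x) d
  depth⁻ x = Dist-restrict (subst₂ (λ a b → Dist T a b d) (sym (embed-restrict c≢r)) (sym (embed-leaf⁻ x))
                                   (Dist-fromChild x))

  Dist-leaves : ∀ {x y ℓ} → Dist T⁻ (leaf⁻ x) (leaf⁻ y) ℓ → Dist T (leaf x) (leaf y) ℓ
  Dist-leaves {x} {y} D = subst₂ (λ a b → Dist T a b _) (embed-leaf⁻ x) (embed-leaf⁻ y) (Dist-embed D)

  coherent⁻ : ∀ x₁ y₁ x₂ y₂ ℓ → Dist T⁻ (leaf⁻ x₁) (leaf⁻ y₁) ℓ → Dist T⁻ (leaf⁻ x₂) (leaf⁻ y₂) ℓ →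
              f x₁ ≡ f x₂ → f y₁ ≡ f y₂ → Edge G x₁ y₁ ⇔ Edge G x₂ y₂
  coherent⁻ x₁ y₁ x₂ y₂ ℓ D₁ D₂ = coherent x₁ y₁ x₂ y₂ ℓ (Dist-leaves D₁) (Dist-leaves D₂)

Decomposition-weaken : ∀ {n} {G : SimpleGraph n} {k d d′} → d ≤ d′ →
                       Decomposition G k d → Decomposition G k d′
Decomposition-weaken d≤d′ D = record
  { m = m ; T = T ; isTree = isTree ; internal = internal
  ; σ = σ ; σInj = σInj ; σSurj = σSurj ; σLeaf = σLeaf ; width = width
  ; radius = proj₁ radius , λ u → let (ℓ , ℓ≤d , w) = proj₂ radius u in ℓ , ≤-trans ℓ≤d d≤d′ , w
  }
  where open Decomposition D

lemma4p4 : ∀ {n} (G : SimpleGraph n) (k d : ℕ) → 2 ≤ n →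
    Shrubbery G k d → Decomposition G k d
lemma4p4 G k zero    (s≤s (s≤s z≤n)) Sh = ⊥-elim (zero≢one (Shrubbery-depthZero-trivial Sh zero (suc zero)))
  where
  zero≢one : ∀ {j} → ¬ _≡_ {A = Fin (suc (suc j))} zero (suc zero)
  zero≢one ()
lemma4p4 G k (suc d) n≥2@(s≤s (s≤s z≤n)) Sh with Shrubbery-rootChild Sh zero
... | c , r—c with ShrubberyProperties.branching-or-pendant Sh r—c
...   | inj₁ (c′ , r—c′ , c≢c′) = ShrubberyProperties.decomposition-of-branching Sh r—c r—c′ c≢c′
...   | inj₂ only-c = Decomposition-weaken (n≤1+n d) (lemma4p4 G k d n≥2 (Shrubbery-deleteRoot Sh r—c only-c))
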